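{- Let $G$ be a diamond-free CIS graph. Then $\alpha(G)\cdot\omega(G)\ge |V(G)|$. Consequently, $G$ has either a clique or a stable set of size at least $|V(G)|^{1/2}$.
   Context: Graphs are finite and simple. The diamond is $K_4$ minus an edge; diamond-free means no induced diamond. A clique is strong if it intersects every inclusion-maximal stable set; $G$ is CIS if every inclusion-maximal clique of $G$ is strong. $\alpha(G)$ is the maximum size of a stable set and $\omega(G)$ the maximum size of a clique in $G$. -}

module Defs where

open import Data.Nat using (ℕ; _≤_; _*_)
open import Data.Fin using (Fin)
open import Data.Fin.Subset using (Subset; _∈_; _⊆_; ∣_∣)
open import Data.Product using (Σ; _×_; ∃-syntax)
open import Data.Sum using (_⊎_)
open import Relation.Nullary using (¬_; Dec)
open import Relation.Binary.PropositionalEquality using (_≡_; _≢_)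

record Graph (n : ℕ) : Set₁ where
  field
    Adj    : Fin n → Fin n → Set
    sym    : ∀ {u v} → Adj u v → Adj v u
    irrefl : ∀ {u} → ¬ Adj u u
    dec    : ∀ u v → Dec (Adj u v)

module _ {n : ℕ} (G : Graph n) where
  open Graph G

  IsClique : Subset n → Set
  IsClique S = ∀ u v → u ∈ S → v ∈ S → u ≢ v → Adj u v

  IsStable : Subset n → Set
  IsStable S = ∀ u v → u ∈ S → v ∈ S → ¬ Adj u v

  IsMaximalClique : Subset n → Set
  IsMaximalClique C = IsClique C × (∀ T → IsClique T → C ⊆ T → T ⊆ C)

  IsMaximalStable : Subset n → Set
  IsMaximalStable I = IsStable I × (∀ T → IsStable T → I ⊆ T → T ⊆ I)

  IsStrong : Subset n → Set
  IsStrong C = ∀ I → IsMaximalStable I → ∃[ v ] (v ∈ C × v ∈ I)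

  IsCIS : Set
  IsCIS = ∀ C → IsMaximalClique C → IsStrong C

  -- no induced diamond (K4 minus the edge cd); a,b,c,d pairwise distinct
  -- (all distinctness except c ≢ d follows from adjacency/irreflexivity)
  DiamondFree : Set
  DiamondFree = ∀ a b c d → Adj a b → Adj a c → Adj a d → Adj b c → Adj b d
                → c ≢ d → Adj c d

  IsAlpha : ℕ → Set
  IsAlpha k = (∃[ S ] (IsStable S × ∣ S ∣ ≡ k)) × (∀ S → IsStable S → ∣ S ∣ ≤ k)

  IsOmega : ℕ → Set
  IsOmega k = (∃[ S ] (IsClique S × ∣ S ∣ ≡ k)) × (∀ S → IsClique S → ∣ S ∣ ≤ k)

-- Let J be a maximum stable set and m(v) = |N(v) ∩ J|. For an edge zv with z ∈ J, extend
-- (J ∖ N(v)) ∪ {v} to a maximal stable set I; since J is maximum, |I ∩ N(z)| ≤ m(v). In a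
-- diamond-free graph K(z,u) = {z} ∪ (N(z) ∩ N[u]) is a maximal clique for every edge zu; being strong
-- it meets I, necessarily at some t ∈ I ∩ N(z), and then u ∈ N(z) ∩ N[t]. So N(z) is covered by at
-- most m(v) sets N(z) ∩ N[t] of size at most ω − 1, i.e. deg z ≤ (ω − 1) m(v). Now let every z ∈ J
-- spread a unit of weight evenly over its neighbours: each v ∉ J has m(v) ≥ 1 neighbours in J and
-- receives at least 1/(ω − 1), while the total weight is at most |J| = α. Hence n − α ≤ (ω − 1) α.
module Submission where

open import Defs
open import Level using (Level)
open import Data.Nat using (ℕ; zero; suc; >-nonZero; _∸_; _+_; _*_; _≤_; _≤?_; _<?_; z≤n; pred; _/_; _!)
open import Data.Nat.Properties hiding (_≟_)
open import Data.Nat.DivMod using (m/n*n≤m; m/n*n≡m)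
open import Data.Nat.Divisibility using (∣-trans; m∣m*n; m≤n⇒m!∣n!)
open import Data.Fin using (Fin; zero; suc; _≟_)
open import Data.Fin.Properties using (any?; all?)
open import Data.Fin.Subset using (Subset; _∈_; _∉_; _⊆_; ∣_∣; ⊥; ∁; _∪_; ⁅_⁆)
open import Data.Fin.Subset.Properties
  using (_∈?_; _⊆?_; ∣p∣≤n; ∉⊥; p⊂q⇒∣p∣<∣q∣; anySubset?; ∣∁p∣≡n∸∣p∣; x∈∁p⇒x∉p;
         x∈p∪q⁻; x∈p∪q⁺; p⊆p∪q; x∈⁅x⁆; x∈⁅y⁆⇒x≡y; ∣⁅x⁆∣≡1; ⊆-trans)
open import Data.Bool using (true; false; if_then_else_)
open import Data.Vec using ([]; _∷_; tabulate)
open import Data.Vec.Properties using (lookup∘tabulate; []=⇒lookup; lookup⇒[]=)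
open import Data.Product using (Σ-syntax; ∃-syntax; _×_; _,_; proj₁; proj₂)
open import Data.Sum using (_⊎_; inj₁; inj₂)
import Data.Sum as Sum
open import Function using (_∘_; id)
open import Relation.Unary using (Pred; Decidable)
open import Relation.Nullary using (Dec; yes; no; ¬_; does; contradiction)
open import Relation.Nullary.Decidable using (_×-dec_; _⊎-dec_; ¬?; _→-dec_)
open import Relation.Binary.PropositionalEquality
open import Algebra.Properties.CommutativeSemigroup *-commutativeSemigroup using (x∙yz≈y∙xz)
open import Algebra.Properties.Semiring.Sum +-*-semiring
  using (sum; sum-cong-≗; sum-replicate-zero; ∑-distrib-+; ∑-comm; *-distribˡ-sum; *-distribʳ-sum)

private variable
  m n : ℕ
  p q ℓ : Level

∑-mono-≤ : {f g : Fin n → ℕ} → (∀ i → f i ≤ g i) → sum f ≤ sum g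
∑-mono-≤ {zero}  f≤g = z≤n
∑-mono-≤ {suc n} f≤g = +-mono-≤ (f≤g zero) (∑-mono-≤ (f≤g ∘ suc))

term≤sum : (f : Fin n → ℕ) (i : Fin n) → f i ≤ sum f
term≤sum f zero    = m≤m+n (f zero) _
term≤sum f (suc i) = ≤-trans (term≤sum (f ∘ suc) i) (m≤n+m _ (f zero))

¬Fin⇒≡0 : ¬ Fin n → n ≡ 0
¬Fin⇒≡0 {zero}  _    = refl
¬Fin⇒≡0 {suc n} ¬Fin = contradiction zero ¬Fin

m≤a*b⇒m≤a*a⊎m≤b*b : ∀ a b → m ≤ a * b → m ≤ a * a ⊎ m ≤ b * b
m≤a*b⇒m≤a*a⊎m≤b*b a b m≤ab with a ≤? b
... | yes a≤b = inj₂ (≤-trans m≤ab (*-monoˡ-≤ b a≤b))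
... | no a≰b  = inj₁ (≤-trans m≤ab (*-monoʳ-≤ a (≰⇒≥ a≰b)))

⟦_⟧ : {P : Set p} → Dec P → ℕ
⟦ P? ⟧ = if does P? then 1 else 0

⟦⟧-yes : {P : Set p} (P? : Dec P) → P → ⟦ P? ⟧ ≡ 1
⟦⟧-yes (yes _) _  = refl
⟦⟧-yes (no ¬p) p = contradiction p ¬p

⟦⟧-no : {P : Set p} (P? : Dec P) → ¬ P → ⟦ P? ⟧ ≡ 0
⟦⟧-no (yes p) ¬p = contradiction p ¬p
⟦⟧-no (no _)  _  = refl

⟦⟧-≤ : {P : Set p} {k : ℕ} (P? : Dec P) → (P → 1 ≤ k) → ⟦ P? ⟧ ≤ k
⟦⟧-≤ (yes p) 1≤k = 1≤k p
⟦⟧-≤ (no _)  _   = z≤n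

⟦⟧*-≤ : {P : Set p} {a b : ℕ} (P? : Dec P) → (P → a ≤ b) → ⟦ P? ⟧ * a ≤ b
⟦⟧*-≤ (yes p) a≤b = ≤-trans (≤-reflexive (*-identityˡ _)) (a≤b p)
⟦⟧*-≤ (no _)  _   = z≤n

⟦⟧*-mono-≤ : {P : Set p} {a b : ℕ} (P? : Dec P) → (P → a ≤ b) → ⟦ P? ⟧ * a ≤ ⟦ P? ⟧ * b
⟦⟧*-mono-≤ (yes p) a≤b = *-monoʳ-≤ 1 (a≤b p)
⟦⟧*-mono-≤ (no _)  _   = z≤n

⟦⟧-mono-≤ : {P : Set p} {Q : Set q} (P? : Dec P) (Q? : Dec Q) → (P → Q) → ⟦ P? ⟧ ≤ ⟦ Q? ⟧
⟦⟧-mono-≤ P? Q? P⇒Q = ⟦⟧-≤ P? (λ p → ≤-reflexive (sym (⟦⟧-yes Q? (P⇒Q p))))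

⟦⟧-⊎ : {P : Set p} {Q : Set q} (P? : Dec P) (Q? : Dec Q) →
       ¬ (P × Q) → ⟦ P? ⊎-dec Q? ⟧ ≡ ⟦ P? ⟧ + ⟦ Q? ⟧
⟦⟧-⊎ (yes p) (yes q) ¬pq = contradiction (p , q) ¬pq
⟦⟧-⊎ (yes _) (no _)  _   = refl
⟦⟧-⊎ (no _)  (yes _) _   = refl
⟦⟧-⊎ (no _)  (no _)  _   = refl

⟦⟧-split : {P : Set p} {Q : Set q} (P? : Dec P) (Q? : Dec Q) →
           ⟦ P? ⟧ ≡ ⟦ P? ×-dec Q? ⟧ + ⟦ P? ×-dec ¬? Q? ⟧
⟦⟧-split (yes _) (yes _) = refl
⟦⟧-split (yes _) (no _)  = refl
⟦⟧-split (no _)  _       = refl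

count : {P : Pred (Fin n) p} → Decidable P → ℕ
count P? = sum (λ x → ⟦ P? x ⟧)

count-pos : {P : Pred (Fin n) p} (P? : Decidable P) → ∀ {x} → P x → 1 ≤ count P?
count-pos P? {x} px = ≤-trans (≤-reflexive (sym (⟦⟧-yes (P? x) px))) (term≤sum _ x)

count-empty : {P : Pred (Fin n) p} (P? : Decidable P) → (∀ x → ¬ P x) → count P? ≡ 0
count-empty {n} P? ¬P = trans (sum-cong-≗ (λ x → ⟦⟧-no (P? x) (¬P x))) (sum-replicate-zero n)

module _ {P : Pred (Fin n) p} {Q : Pred (Fin n) q} (P? : Decidable P) (Q? : Decidable Q) where

  count-⊎ : (∀ {x} → ¬ (P x × Q x)) → count (λ x → P? x ⊎-dec Q? x) ≡ count P? + count Q?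
  count-⊎ disjoint =
    trans (sum-cong-≗ (λ x → ⟦⟧-⊎ (P? x) (Q? x) disjoint)) (∑-distrib-+ (λ x → ⟦ P? x ⟧) (λ x → ⟦ Q? x ⟧))

  count-split : count P? ≡ count (λ x → P? x ×-dec Q? x) + count (λ x → P? x ×-dec ¬? (Q? x))
  count-split = trans (sum-cong-≗ (λ x → ⟦⟧-split (P? x) (Q? x)))
    (∑-distrib-+ (λ x → ⟦ P? x ×-dec Q? x ⟧) (λ x → ⟦ P? x ×-dec ¬? (Q? x) ⟧))

count-mono-≤ : {P : Pred (Fin n) p} {Q : Pred (Fin n) q} (P? : Decidable P) (Q? : Decidable Q) →
               (∀ {x} → P x → Q x) → count P? ≤ count Q?
count-mono-≤ P? Q? P⇒Q = ∑-mono-≤ (λ x → ⟦⟧-mono-≤ (P? x) (Q? x) P⇒Q)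

count-cong : {P : Pred (Fin n) p} {Q : Pred (Fin n) q} (P? : Decidable P) (Q? : Decidable Q) →
             (∀ {x} → P x → Q x) → (∀ {x} → Q x → P x) → count P? ≡ count Q?
count-cong P? Q? P⇒Q Q⇒P = ≤-antisym (count-mono-≤ P? Q? P⇒Q) (count-mono-≤ Q? P? Q⇒P)

∣p∣≡count∈ : (p : Subset n) → ∣ p ∣ ≡ count (_∈? p)
∣p∣≡count∈ []          = refl
∣p∣≡count∈ (true ∷ p)  = cong suc (∣p∣≡count∈ p)
∣p∣≡count∈ (false ∷ p) = ∣p∣≡count∈ p

⟪_⟫ : {P : Pred (Fin n) p} → Decidable P → Subset n
⟪ P? ⟫ = tabulate (does ∘ P?)

module _ {P : Pred (Fin n) p} (P? : Decidable P) where

  ∈⟪⟫⁻ : ∀ {x} → x ∈ ⟪ P? ⟫ → P x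
  ∈⟪⟫⁻ {x} x∈ with P? x | trans (sym (lookup∘tabulate (does ∘ P?) x)) ([]=⇒lookup x∈)
  ... | yes px | _ = px
  ... | no _   | ()

  ∈⟪⟫⁺ : ∀ {x} → P x → x ∈ ⟪ P? ⟫
  ∈⟪⟫⁺ {x} px = lookup⇒[]= x ⟪ P? ⟫ (trans (lookup∘tabulate (does ∘ P?) x) (does-yes (P? x)))
    where
    does-yes : (P?x : Dec (P x)) → does P?x ≡ true
    does-yes (yes _)  = refl
    does-yes (no ¬px) = contradiction px ¬px

  ∣⟪⟫∣ : ∣ ⟪ P? ⟫ ∣ ≡ count P?
  ∣⟪⟫∣ = trans (∣p∣≡count∈ ⟪ P? ⟫) (count-cong (_∈? ⟪ P? ⟫) P? ∈⟪⟫⁻ ∈⟪⟫⁺)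

  count≤n : count P? ≤ n
  count≤n = subst (_≤ n) ∣⟪⟫∣ (∣p∣≤n ⟪ P? ⟫)

module _ {R : Fin m → Fin n → Set ℓ} (R? : ∀ t u → Dec (R t u)) where

  count-≤-cover : {P : Pred (Fin m) p} {Q : Pred (Fin n) q} (P? : Decidable P) (Q? : Decidable Q) (k : ℕ)
    → (∀ {t} → P t → count (R? t) ≤ k)
    → (∀ {u} → Q u → ∃[ t ] (P t × R t u))
    → count Q? ≤ count P? * k
  count-≤-cover P? Q? k R-small covered = begin
    count Q?                                          ≤⟨ ∑-mono-≤ hit ⟩
    sum (λ u → sum (λ t → ⟦ P? t ⟧ * ⟦ R? t u ⟧))     ≡⟨ ∑-comm (λ u t → ⟦ P? t ⟧ * ⟦ R? t u ⟧) ⟩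
    sum (λ t → sum (λ u → ⟦ P? t ⟧ * ⟦ R? t u ⟧))     ≡⟨ sum-cong-≗ (λ t → *-distribˡ-sum ⟦ P? t ⟧ (λ u → ⟦ R? t u ⟧)) ⟨
    sum (λ t → ⟦ P? t ⟧ * count (R? t))               ≤⟨ ∑-mono-≤ (λ t → ⟦⟧*-mono-≤ (P? t) R-small) ⟩
    sum (λ t → ⟦ P? t ⟧ * k)                          ≡⟨ *-distribʳ-sum k (λ t → ⟦ P? t ⟧) ⟨
    count P? * k                                      ∎
    where
    open ≤-Reasoning
    hit : ∀ u → ⟦ Q? u ⟧ ≤ sum (λ t → ⟦ P? t ⟧ * ⟦ R? t u ⟧)
    hit u = ⟦⟧-≤ (Q? u) λ qu → let (t , pt , rtu) = covered qu in
      ≤-trans (≤-reflexive (sym (cong₂ _*_ (⟦⟧-yes (P? t) pt) (⟦⟧-yes (R? t u) rtu)))) (term≤sum _ t)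

  -- A fractional double count with weights m ! / s z on the targets z, where s z is the number
  -- of sources related to z; m ! clears all the denominators since s z ≤ m.
  fractional-double-counting : {B : Pred (Fin m) p} {A : Pred (Fin n) q}
    (B? : Decidable B) (A? : Decidable A) (c : ℕ)
    → (∀ {v z} → R v z → A z)
    → (∀ {v} → B v → 1 ≤ count (R? v))
    → (∀ {v z} → R v z → count (λ u → R? u z) ≤ c * count (R? v))
    → count B? ≤ c * count A?
  fractional-double-counting B? A? c R⇒A B-related balanced = *-cancelʳ-≤ _ _ L ⦃ m !≢0 ⦄ (begin
    count B? * L                                       ≡⟨ *-distribʳ-sum L (λ v → ⟦ B? v ⟧) ⟩
    sum (λ v → ⟦ B? v ⟧ * L)                           ≤⟨ ∑-mono-≤ per-source ⟩
    sum (λ v → c * sum (λ z → ⟦ R? v z ⟧ * wt z))      ≡⟨ *-distribˡ-sum c (λ v → sum (λ z → ⟦ R? v z ⟧ * wt z)) ⟨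
    c * sum (λ v → sum (λ z → ⟦ R? v z ⟧ * wt z))      ≡⟨ cong (c *_) (∑-comm (λ v z → ⟦ R? v z ⟧ * wt z)) ⟩
    c * sum (λ z → sum (λ v → ⟦ R? v z ⟧ * wt z))      ≡⟨ cong (c *_) (sum-cong-≗ (λ z → *-distribʳ-sum (wt z) (λ v → ⟦ R? v z ⟧))) ⟨
    c * sum (λ z → s z * wt z)                         ≤⟨ *-monoʳ-≤ c (∑-mono-≤ per-target) ⟩
    c * sum (λ z → ⟦ A? z ⟧ * L)                       ≡⟨ cong (c *_) (*-distribʳ-sum L (λ z → ⟦ A? z ⟧)) ⟨
    c * (count A? * L)                                 ≡⟨ *-assoc c _ L ⟨
    c * count A? * L                                   ∎)
    where
    open ≤-Reasoning
    L : ℕ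
    L = m !
    r : Fin m → ℕ
    r v = count (R? v)
    s : Fin n → ℕ
    s z = count (λ v → R? v z)
    -- the weight of an unrelated target (s z = 0) is junk, but it only ever gets multiplied by 0
    wt : Fin n → ℕ
    wt z = L / suc (pred (s z))

    wt*s≤L : ∀ z → wt z * s z ≤ L
    wt*s≤L z with s z
    ... | zero  = ≤-trans (≤-reflexive (*-zeroʳ (L / 1))) z≤n
    ... | suc k = m/n*n≤m L (suc k)

    wt*s≡L : ∀ {v z} → R v z → wt z * s z ≡ L
    wt*s≡L {v} {z} rvz with s z | count-pos (λ u → R? u z) rvz | count≤n (λ u → R? u z)
    ... | suc k | _ | s≤m = m/n*n≡m (∣-trans (m∣m*n (k !)) (m≤n⇒m!∣n! s≤m))

    per-edge : ∀ v z → ⟦ R? v z ⟧ * L ≤ (r v * c) * (⟦ R? v z ⟧ * wt z)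
    per-edge v z = ≤-trans (⟦⟧*-mono-≤ (R? v z) L≤) (≤-reflexive (x∙yz≈y∙xz ⟦ R? v z ⟧ (r v * c) (wt z)))
      where
      L≤ : R v z → L ≤ r v * c * wt z
      L≤ rvz = begin
        L               ≡⟨ wt*s≡L rvz ⟨
        wt z * s z      ≤⟨ *-monoʳ-≤ (wt z) (balanced rvz) ⟩
        wt z * (c * r v) ≡⟨ *-comm (wt z) _ ⟩
        c * r v * wt z  ≡⟨ cong (_* wt z) (*-comm c (r v)) ⟩
        r v * c * wt z  ∎

    per-source : ∀ v → ⟦ B? v ⟧ * L ≤ c * sum (λ z → ⟦ R? v z ⟧ * wt z)
    per-source v = ⟦⟧*-≤ (B? v) λ bv →
      *-cancelˡ-≤ (r v) ⦃ >-nonZero (B-related bv) ⦄ (begin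
        r v * L                                         ≡⟨ *-distribʳ-sum L (λ z → ⟦ R? v z ⟧) ⟩
        sum (λ z → ⟦ R? v z ⟧ * L)                      ≤⟨ ∑-mono-≤ (per-edge v) ⟩
        sum (λ z → (r v * c) * (⟦ R? v z ⟧ * wt z))     ≡⟨ *-distribˡ-sum (r v * c) (λ z → ⟦ R? v z ⟧ * wt z) ⟨
        (r v * c) * sum (λ z → ⟦ R? v z ⟧ * wt z)       ≡⟨ *-assoc (r v) c _ ⟩
        r v * (c * sum (λ z → ⟦ R? v z ⟧ * wt z))       ∎)

    per-target : ∀ z → s z * wt z ≤ ⟦ A? z ⟧ * L
    per-target z with A? z
    ... | yes _ = ≤-trans (≤-reflexive (*-comm (s z) (wt z))) (≤-trans (wt*s≤L z) (≤-reflexive (sym (*-identityˡ L))))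
    ... | no ¬az = ≤-reflexive (cong (_* wt z) (count-empty (λ u → R? u z) (λ u → ¬az ∘ R⇒A)))

module _ (P : Pred (Subset n) p) where

  IsLargest : Subset n → Set p
  IsLargest T = P T × (∀ U → P U → ∣ U ∣ ≤ ∣ T ∣)

  IsMaximal : Subset n → Set p
  IsMaximal T = P T × (∀ U → P U → T ⊆ U → U ⊆ T)

largest : {P : Pred (Subset n) p} → Decidable P → ∀ {S} → P S → Σ[ T ∈ Subset n ] IsLargest P T
largest {n} {P = P} P? {S} pS = search n S pS (m≤m+n n ∣ S ∣)
  where
  -- each step strictly increases ∣ S ∣, which is at most n
  search : ∀ fuel S → P S → n ≤ fuel + ∣ S ∣ → Σ[ T ∈ Subset n ] IsLargest P T
  search zero S pS n≤∣S∣ = S , pS , λ U _ → ≤-trans (∣p∣≤n U) n≤∣S∣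
  search (suc fuel) S pS n≤ with anySubset? (λ U → P? U ×-dec ∣ S ∣ <? ∣ U ∣)
  ... | yes (U , pU , ∣S∣<∣U∣) = search fuel U pU
    (≤-trans n≤ (≤-trans (≤-reflexive (sym (+-suc fuel ∣ S ∣))) (+-monoʳ-≤ fuel ∣S∣<∣U∣)))
  ... | no ∄larger = S , pS , λ U pU → ≮⇒≥ (λ ∣S∣<∣U∣ → ∄larger (U , pU , ∣S∣<∣U∣))

extend-to-maximal : {P : Pred (Subset n) p} → Decidable P → ∀ {S} → P S →
                    Σ[ T ∈ Subset n ] (IsMaximal P T × S ⊆ T)
extend-to-maximal {P = P} P? {S} pS with largest (λ U → P? U ×-dec S ⊆? U) (pS , id)
... | T , (pT , S⊆T) , T-largest = T , (pT , maximal) , S⊆T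
  where
  maximal : ∀ U → P U → T ⊆ U → U ⊆ T
  maximal U pU T⊆U {x} x∈U with x ∈? T
  ... | yes x∈T = x∈T
  ... | no x∉T  = contradiction (T-largest U (pU , ⊆-trans S⊆T T⊆U))
                                (<⇒≱ (p⊂q⇒∣p∣<∣q∣ (T⊆U , x , x∈U , x∉T)))

module _ {n} (G : Graph n) where
  open Graph G renaming (sym to Adj-sym)

  isStable? : Decidable (IsStable G)
  isStable? S = all? λ u → all? λ v → u ∈? S →-dec (v ∈? S →-dec ¬? (dec u v))

  isClique? : Decidable (IsClique G)
  isClique? S = all? λ u → all? λ v → u ∈? S →-dec (v ∈? S →-dec (¬? (u ≟ v) →-dec dec u v))

  ⊥-isStable : IsStable G ⊥
  ⊥-isStable u _ u∈⊥ = contradiction u∈⊥ ∉⊥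

  ⊥-isClique : IsClique G ⊥
  ⊥-isClique u _ u∈⊥ = contradiction u∈⊥ ∉⊥

  ⁅⁆-isClique : ∀ x → IsClique G ⁅ x ⁆
  ⁅⁆-isClique x u v u∈ v∈ u≢v = contradiction (trans (x∈⁅y⁆⇒x≡y x u∈) (sym (x∈⁅y⁆⇒x≡y x v∈))) u≢v

  degree : Fin n → ℕ
  degree z = count (dec z)

  EdgeNbr : Fin n → Fin n → Pred (Fin n) _
  EdgeNbr z t u = Adj z u × (u ≡ t ⊎ Adj t u)

  edgeNbr? : ∀ z t → Decidable (EdgeNbr z t)
  edgeNbr? z t u = dec z u ×-dec (u ≟ t ⊎-dec dec t u)

  inK? : ∀ z t → Decidable (λ u → u ≡ z ⊎ EdgeNbr z t u)
  inK? z t u = u ≟ z ⊎-dec edgeNbr? z t u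

  K : Fin n → Fin n → Subset n
  K z t = ⟪ inK? z t ⟫

  ∣K∣ : ∀ z t → ∣ K z t ∣ ≡ 1 + count (edgeNbr? z t)
  ∣K∣ z t = begin
    ∣ K z t ∣                                 ≡⟨ ∣⟪⟫∣ (inK? z t) ⟩
    count (inK? z t)                          ≡⟨ count-⊎ (_≟ z) (edgeNbr? z t) (λ { (refl , zz , _) → irrefl zz }) ⟩
    count (_≟ z) + count (edgeNbr? z t)       ≡⟨ cong (_+ count (edgeNbr? z t)) count-≡ ⟩
    1 + count (edgeNbr? z t)                  ∎
    where
    open ≡-Reasoning
    count-≡ : count (_≟ z) ≡ 1
    count-≡ = trans (count-cong (_≟ z) (_∈? ⁅ z ⁆) (λ { refl → x∈⁅x⁆ z }) (x∈⁅y⁆⇒x≡y z))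
                    (trans (sym (∣p∣≡count∈ ⁅ z ⁆)) (∣⁅x⁆∣≡1 z))

  module _ (diamond-free : DiamondFree G) {z t} (zt : Adj z t) where

    K-isClique : IsClique G (K z t)
    K-isClique u₁ u₂ u₁∈ u₂∈ u₁≢u₂ with ∈⟪⟫⁻ (inK? z t) u₁∈ | ∈⟪⟫⁻ (inK? z t) u₂∈
    ... | inj₁ refl             | inj₁ refl             = contradiction refl u₁≢u₂
    ... | inj₁ refl             | inj₂ (zu₂ , _)         = zu₂
    ... | inj₂ (zu₁ , _)        | inj₁ refl              = Adj-sym zu₁
    ... | inj₂ (_ , inj₁ refl)  | inj₂ (_ , inj₁ refl)   = contradiction refl u₁≢u₂
    ... | inj₂ (_ , inj₁ refl)  | inj₂ (_ , inj₂ tu₂)    = tu₂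
    ... | inj₂ (_ , inj₂ tu₁)   | inj₂ (_ , inj₁ refl)   = Adj-sym tu₁
    ... | inj₂ (zu₁ , inj₂ tu₁) | inj₂ (zu₂ , inj₂ tu₂)  = diamond-free z t u₁ u₂ zt zu₁ zu₂ tu₁ tu₂ u₁≢u₂

    z∈K : z ∈ K z t
    z∈K = ∈⟪⟫⁺ (inK? z t) (inj₁ refl)

    t∈K : t ∈ K z t
    t∈K = ∈⟪⟫⁺ (inK? z t) (inj₂ (zt , inj₁ refl))

    K-isMaximalClique : IsMaximalClique G (K z t)
    K-isMaximalClique = K-isClique , λ T T-clique K⊆T u∈T → ∈⟪⟫⁺ (inK? z t) (inK T-clique K⊆T u∈T)
      where
      adj : ∀ {T} → IsClique G T → K z t ⊆ T → ∀ {u w} → u ∈ T → w ∈ K z t → u ≢ w → Adj w u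
      adj T-clique K⊆T u∈T w∈K u≢w = T-clique _ _ (K⊆T w∈K) u∈T (u≢w ∘ sym)

      inK : ∀ {T} → IsClique G T → K z t ⊆ T → ∀ {u} → u ∈ T → u ≡ z ⊎ EdgeNbr z t u
      inK T-clique K⊆T {u} u∈T with u ≟ z | u ≟ t
      ... | yes u≡z | _       = inj₁ u≡z
      ... | no u≢z  | yes u≡t = inj₂ (adj T-clique K⊆T u∈T z∈K u≢z , inj₁ u≡t)
      ... | no u≢z  | no u≢t  = inj₂ (adj T-clique K⊆T u∈T z∈K u≢z , inj₂ (adj T-clique K⊆T u∈T t∈K u≢t))

  strong-cover : DiamondFree G → IsCIS G → ∀ {I z v} → IsMaximalStable G I → v ∈ I → Adj z v →
                 ∀ {u} → Adj z u → ∃[ t ] ((t ∈ I × Adj z t) × EdgeNbr z t u)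
  strong-cover diamond-free cis {I} I-maximal v∈I zv {u} zu
    with cis (K _ u) (K-isMaximalClique diamond-free zu) I I-maximal
  ... | t , t∈K , t∈I with ∈⟪⟫⁻ (inK? _ u) t∈K
  ...   | inj₁ refl          = contradiction zv (proj₁ I-maximal t _ t∈I v∈I)
  ...   | inj₂ (zt , t≡u⊎ut) = t , (t∈I , zt) , zu , Sum.map sym Adj-sym t≡u⊎ut

  IsMaximumStable : Subset n → Set
  IsMaximumStable = IsLargest (IsStable G)

  IsCliqueBound : ℕ → Set
  IsCliqueBound w = ∀ S → IsClique G S → ∣ S ∣ ≤ w

  module _ {J} (J-maximum : IsMaximumStable J) where

    J-stable : IsStable G J
    J-stable = proj₁ J-maximum

    NbrInJ : Fin n → Pred (Fin n) _
    NbrInJ v x = x ∈ J × Adj v x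

    nbrInJ? : ∀ v → Decidable (NbrInJ v)
    nbrInJ? v x = x ∈? J ×-dec dec v x

    maximum-stable-dominating : ∀ {v} → v ∉ J → ∃[ x ] NbrInJ v x
    maximum-stable-dominating {v} v∉J with any? (nbrInJ? v)
    ... | yes nbr = nbr
    ... | no ∄nbr = contradiction (proj₂ J-maximum (J ∪ ⁅ v ⁆) J+v-stable)
                                  (<⇒≱ (p⊂q⇒∣p∣<∣q∣ (p⊆p∪q ⁅ v ⁆ , v , x∈p∪q⁺ (inj₂ (x∈⁅x⁆ v)) , v∉J)))
      where
      J+v-stable : IsStable G (J ∪ ⁅ v ⁆)
      J+v-stable x y x∈ y∈ with x∈p∪q⁻ J ⁅ v ⁆ x∈ | x∈p∪q⁻ J ⁅ v ⁆ y∈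
      ... | inj₁ x∈J | inj₁ y∈J = J-stable x y x∈J y∈J
      ... | inj₁ x∈J | inj₂ y∈v rewrite x∈⁅y⁆⇒x≡y v y∈v = λ xv → ∄nbr (x , x∈J , Adj-sym xv)
      ... | inj₂ x∈v | inj₁ y∈J rewrite x∈⁅y⁆⇒x≡y v x∈v = λ vy → ∄nbr (y , y∈J , vy)
      ... | inj₂ x∈v | inj₂ y∈v rewrite x∈⁅y⁆⇒x≡y v x∈v | x∈⁅y⁆⇒x≡y v y∈v = irrefl

    Exchanged : Fin n → Pred (Fin n) _
    Exchanged v x = (x ∈ J × ¬ Adj v x) ⊎ x ≡ v

    exchanged? : ∀ v → Decidable (Exchanged v)
    exchanged? v x = (x ∈? J ×-dec ¬? (dec v x)) ⊎-dec x ≟ v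

    exchanged-isStable : ∀ v → IsStable G ⟪ exchanged? v ⟫
    exchanged-isStable v x y x∈ y∈ with ∈⟪⟫⁻ (exchanged? v) x∈ | ∈⟪⟫⁻ (exchanged? v) y∈
    ... | inj₁ (x∈J , _) | inj₁ (y∈J , _) = J-stable x y x∈J y∈J
    ... | inj₁ (_ , ¬vx) | inj₂ refl      = ¬vx ∘ Adj-sym
    ... | inj₂ refl      | inj₁ (_ , ¬vy) = ¬vy
    ... | inj₂ refl      | inj₂ refl      = irrefl

    exchange : ∀ v → Σ[ I ∈ Subset n ] (IsMaximalStable G I × (∀ {x} → Exchanged v x → x ∈ I))
    exchange v with extend-to-maximal isStable? (exchanged-isStable v)
    ... | I , I-maximal , ⊆I = I , I-maximal , ⊆I ∘ ∈⟪⟫⁺ (exchanged? v)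

    exchange-bound : ∀ {I z v} → IsStable G I → (∀ {x} → Exchanged v x → x ∈ I) → z ∈ J →
                     count (λ t → t ∈? I ×-dec dec z t) ≤ count (nbrInJ? v)
    exchange-bound {I} {z} {v} I-stable ⊇exchanged z∈J = +-cancelˡ-≤ (count kept?) _ _ (begin
      count kept? + count I∩N?                ≡⟨ count-⊎ kept? I∩N? disjoint ⟨
      count (λ x → kept? x ⊎-dec I∩N? x)      ≤⟨ count-mono-≤ (λ x → kept? x ⊎-dec I∩N? x) (_∈? I) in-I ⟩
      count (_∈? I)                           ≡⟨ ∣p∣≡count∈ I ⟨
      ∣ I ∣                                    ≤⟨ proj₂ J-maximum I I-stable ⟩
      ∣ J ∣                                    ≡⟨ ∣p∣≡count∈ J ⟩
      count (_∈? J)                           ≡⟨ count-split (_∈? J) (dec v) ⟩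
      count (nbrInJ? v) + count kept?         ≡⟨ +-comm _ (count kept?) ⟩
      count kept? + count (nbrInJ? v)         ∎)
      where
      open ≤-Reasoning
      kept? : Decidable (λ x → x ∈ J × ¬ Adj v x)
      kept? x = x ∈? J ×-dec ¬? (dec v x)
      I∩N? : Decidable (λ t → t ∈ I × Adj z t)
      I∩N? t = t ∈? I ×-dec dec z t
      disjoint : ∀ {x} → ¬ ((x ∈ J × ¬ Adj v x) × (x ∈ I × Adj z x))
      disjoint {x} ((x∈J , _) , (_ , zx)) = J-stable z x z∈J x∈J zx
      in-I : ∀ {x} → (x ∈ J × ¬ Adj v x) ⊎ (x ∈ I × Adj z x) → x ∈ I
      in-I (inj₁ kept) = ⊇exchanged (inj₁ kept)
      in-I (inj₂ (x∈I , _)) = x∈I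

    module _ (diamond-free : DiamondFree G) (cis : IsCIS G) {w} (ω≤w : IsCliqueBound w) where

      edgeNbr-bound : ∀ {z t} → Adj z t → count (edgeNbr? z t) ≤ pred w
      edgeNbr-bound {z} {t} zt =
        suc[m]≤n⇒m≤pred[n] (subst (_≤ w) (∣K∣ z t) (ω≤w (K z t) (K-isClique diamond-free zt)))

      degree-bound : ∀ {z v} → z ∈ J → Adj z v → degree z ≤ count (nbrInJ? v) * pred w
      degree-bound {z} {v} z∈J zv with exchange v
      ... | I , I-maximal , ⊇exchanged = begin
        degree z                      ≤⟨ count-≤-cover (edgeNbr? z) I∩N? (dec z) (pred w) (edgeNbr-bound ∘ proj₂) covered ⟩
        count I∩N? * pred w           ≤⟨ *-monoˡ-≤ (pred w) (exchange-bound (proj₁ I-maximal) ⊇exchanged z∈J) ⟩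
        count (nbrInJ? v) * pred w    ∎
        where
        open ≤-Reasoning
        I∩N? : Decidable (λ t → t ∈ I × Adj z t)
        I∩N? t = t ∈? I ×-dec dec z t
        covered : ∀ {u} → Adj z u → ∃[ t ] ((t ∈ I × Adj z t) × EdgeNbr z t u)
        covered = strong-cover diamond-free cis I-maximal (⊇exchanged (inj₂ refl)) zv

      ∣∁J∣≤ : ∣ ∁ J ∣ ≤ pred w * ∣ J ∣
      ∣∁J∣≤ = begin
        ∣ ∁ J ∣                 ≡⟨ ∣p∣≡count∈ (∁ J) ⟩
        count (_∈? ∁ J)         ≤⟨ fractional-double-counting nbrInJ? (_∈? ∁ J) (_∈? J) (pred w)
                                                              proj₁ has-nbr balanced ⟩
        pred w * count (_∈? J)  ≡⟨ cong (pred w *_) (∣p∣≡count∈ J) ⟨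
        pred w * ∣ J ∣          ∎
        where
        open ≤-Reasoning
        has-nbr : ∀ {v} → v ∈ ∁ J → 1 ≤ count (nbrInJ? v)
        has-nbr {v} v∈∁J = count-pos (nbrInJ? v) (proj₂ (maximum-stable-dominating (x∈∁p⇒x∉p v∈∁J)))
        balanced : ∀ {v z} → NbrInJ v z → count (λ u → nbrInJ? u z) ≤ pred w * count (nbrInJ? v)
        balanced {v} {z} (z∈J , vz) = begin
          count (λ u → nbrInJ? u z)   ≡⟨ count-cong (λ u → nbrInJ? u z) (dec z) (Adj-sym ∘ proj₂) (λ zu → z∈J , Adj-sym zu) ⟩
          degree z                    ≤⟨ degree-bound z∈J (Adj-sym vz) ⟩
          count (nbrInJ? v) * pred w  ≡⟨ *-comm _ (pred w) ⟩
          pred w * count (nbrInJ? v)  ∎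

  n≤α*ω : DiamondFree G → IsCIS G → ∀ {J} → IsMaximumStable J → ∀ w → IsCliqueBound w → n ≤ ∣ J ∣ * w
  n≤α*ω _ _ _ zero ω≤0 = ≤-trans (≤-reflexive (¬Fin⇒≡0 no-vertex)) z≤n
    where
    no-vertex : ¬ Fin n
    no-vertex x = contradiction (subst (_≤ 0) (∣⁅x⁆∣≡1 x) (ω≤0 ⁅ x ⁆ (⁅⁆-isClique x))) λ ()
  n≤α*ω diamond-free cis {J} J-maximum (suc w) ω≤w = begin
    n                    ≡⟨ m+[n∸m]≡n (∣p∣≤n J) ⟨
    ∣ J ∣ + (n ∸ ∣ J ∣)  ≡⟨ cong (∣ J ∣ +_) (∣∁p∣≡n∸∣p∣ J) ⟨
    ∣ J ∣ + ∣ ∁ J ∣      ≤⟨ +-monoʳ-≤ ∣ J ∣ (∣∁J∣≤ J-maximum diamond-free cis ω≤w) ⟩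
    ∣ J ∣ + w * ∣ J ∣    ≡⟨ *-comm (suc w) ∣ J ∣ ⟩
    ∣ J ∣ * suc w        ∎
    where open ≤-Reasoning

theorem2 : (n : ℕ) (G : Graph n) → DiamondFree G → IsCIS G
    → ((a w : ℕ) → IsAlpha G a → IsOmega G w → n ≤ a * w)
      × (∃[ S ] ((IsClique G S ⊎ IsStable G S) × n ≤ ∣ S ∣ * ∣ S ∣))
theorem2 n G diamond-free cis = n≤αω , large-clique-or-stable
  where
  n≤αω : (a w : ℕ) → IsAlpha G a → IsOmega G w → n ≤ a * w
  n≤αω _ w ((J , J-stable , refl) , J-maximum) (_ , ω≤w) = n≤α*ω G diamond-free cis (J-stable , J-maximum) w ω≤w

  large-clique-or-stable : ∃[ S ] ((IsClique G S ⊎ IsStable G S) × n ≤ ∣ S ∣ * ∣ S ∣)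
  large-clique-or-stable
    with largest (isStable? G) (⊥-isStable G) | largest (isClique? G) (⊥-isClique G)
  ... | J , J-maximum | C , C-clique , ω≤∣C∣
    with m≤a*b⇒m≤a*a⊎m≤b*b ∣ J ∣ ∣ C ∣ (n≤α*ω G diamond-free cis J-maximum ∣ C ∣ ω≤∣C∣)
  ...   | inj₁ n≤∣J∣² = J , inj₂ (proj₁ J-maximum) , n≤∣J∣²
  ...   | inj₂ n≤∣C∣² = C , inj₁ C-clique , n≤∣C∣²
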